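{- Let $n$ be a power of $2$, $B$ a positive integer, and $S\subset[n]$. Choose $\sigma$ uniformly at random from the odd numbers in $[n]$ and $b$ uniformly at random from $[n]$. For $i\in[n]$ let $\pi_{\sigma,b}(i)=\sigma(i-b)\bmod n$ and $h_{\sigma,b}(i)=\mathrm{round}(\pi_{\sigma,b}(i)B/n)$. Then for any $i\in S$, the event $h_{\sigma,b}(i)\in h_{\sigma,b}(S\setminus\{i\})$ holds with probability at most $4|S|/B$.
   Context: $[n]=\{1,\dots,n\}$; $\sigma(i-b)\bmod n$ is the representative in $\{0,\dots,n-1\}$; $\mathrm{round}$ rounds a real number to a nearest integer (with a fixed tie-breaking rule); $h_{\sigma,b}(S\setminus\{i\})=\{h_{\sigma,b}(j): j\in S, j\ne i\}$. -}

module Defs where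

open import Data.Nat using (ℕ; zero; suc; _+_; _*_; _∸_; _≤_; _^_; _≡ᵇ_)
open import Data.Nat.DivMod using (_%_)
open import Data.Bool using (Bool; true; false; not; _∧_; if_then_else_)
open import Data.List using (List; []; _∷_; map; upTo; length; filterᵇ; cartesianProduct)
open import Data.Product using (_×_; _,_)
open import Data.Bool.ListAction using (any)

range : ℕ → List ℕ
range n = map suc (upTo n)

odds : ℕ → List ℕ
odds n = filterᵇ (λ x → x % 2 ≡ᵇ 1) (range n)

-- π_{σ,b}(i) = σ(i-b) mod n, representative in {0,…,n-1}.
-- For b ≤ n, i - b ≡ i + n - b (mod n), and i + n - b ≥ 0, so natural subtraction is exact.
perm : (n σ b i : ℕ) → ℕ
perm zero σ b i = 0
perm (suc m) σ b i = (σ * ((i + suc m) ∸ b)) % suc m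

-- r is a rounding-to-nearest function for the denominator n:
-- |r x - x/n| ≤ 1/2, i.e. 2·n·r(x) ≤ 2x + n and 2x ≤ 2·n·r(x) + n.
-- (Any tie-breaking rule is allowed.)
IsRoundDiv : ℕ → (ℕ → ℕ) → Set
IsRoundDiv n r = ∀ x → (2 * n * r x ≤ 2 * x + n) × (2 * x ≤ 2 * n * r x + n)

hash : (n B : ℕ) → (r : ℕ → ℕ) → (σ b i : ℕ) → ℕ
hash n B r σ b i = r (perm n σ b i * B)

collides : (n B : ℕ) → (r : ℕ → ℕ) → (S : List ℕ) → (i σ b : ℕ) → Bool
collides n B r S i σ b =
  any (λ j → not (j ≡ᵇ i) ∧ (hash n B r σ b j ≡ᵇ hash n B r σ b i)) S

count : {A : Set} → (A → Bool) → List A → ℕ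
count p [] = 0
count p (x ∷ xs) = if p x then suc (count p xs) else count p xs

badCount : (n B : ℕ) → (r : ℕ → ℕ) → (S : List ℕ) → (i : ℕ) → ℕ
badCount n B r S i =
  count (λ { (σ , b) → collides n B r S i σ b }) (cartesianProduct (odds n) (range n))

-- By the union bound it suffices to count, for each j ≠ i, the pairs
-- (σ, b) with h(j) = h(i).  Two values that round to the same integer differ
-- by at most n/B before rounding, so a collision forces the residue
-- e = σ·D mod n, with D = i − j + n, to lie within n/B of 0 modulo n
-- (it is "near zero"); this no longer depends on b.  Since 0 < |i − j| < n,
-- n does not divide D, and the key counting lemma shows that at most 2n/B odd
-- σ make σ·D mod n near zero: for odd D, multiplication by D permutes the odd
-- residues mod 2^k, so we count odd residues near zero directly; for even D
-- the question halves to modulus 2^(k−1).  Summing over j and using that at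
-- least n/2 elements of [n] are odd gives the bound #bad · B ≤ 4|S|·#odd·n.
module Submission where

open import Data.Nat using (ℕ; zero; suc; _+_; _*_; _∸_; _≤_; _<_; _^_; _≡ᵇ_; _≤ᵇ_; _<?_; _≟_; NonZero; z≤n; s≤s)
open import Data.Nat.Properties
open import Data.Nat.DivMod
open import Data.Nat.Divisibility using (_∣_; divides; 1∣_; *-monoʳ-∣; m%n≡0⇒n∣m)
open import Data.Nat.Solver using (module +-*-Solver)
open import Data.Bool using (Bool; true; false; not; _∧_; _∨_; if_then_else_; T)
open import Data.Bool.Properties using (T-∨; T-∧; T-not-≡)
open import Data.Product using (_×_; _,_; proj₁; proj₂)
open import Data.List using (List; []; _∷_; map; upTo; length; filterᵇ; cartesianProduct; _++_)
open import Data.List.Properties using (map-++; upTo-∷ʳ; length-map; length-upTo)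
open import Data.List.Relation.Unary.All as All using (All; []; _∷_)
open import Data.List.Relation.Unary.All.Properties using (all-upTo; map⁺)
open import Data.Bool.ListAction using (any)
open import Data.List.Relation.Unary.Unique.Propositional using (Unique)
open import Data.List.Membership.Propositional using (_∈_)
open import Data.Sum using (_⊎_; inj₁; inj₂; [_,_]′)
open import Data.Empty using (⊥; ⊥-elim)
open import Function.Bundles using (Equivalence)
open import Relation.Nullary using (yes; no; ¬_)
open import Relation.Binary.PropositionalEquality
open import Defs
open +-*-Solver using (solve; _:+_; _:*_; _:=_; con)

ind : Bool → ℕ
ind true = 1
ind false = 0

ind≤1 : ∀ b → ind b ≤ 1
ind≤1 true = ≤-refl
ind≤1 false = z≤n

ind-∨ : ∀ a b → ind (a ∨ b) ≤ ind a + ind b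
ind-∨ true b = s≤s z≤n
ind-∨ false b = ≤-refl

sumTo : (ℕ → ℕ) → ℕ → ℕ
sumTo f zero = 0
sumTo f (suc N) = sumTo f N + f (suc N)

sumTo-cong : ∀ {f g} N → (∀ v → 1 ≤ v → v ≤ N → f v ≡ g v) → sumTo f N ≡ sumTo g N
sumTo-cong zero h = refl
sumTo-cong (suc N) h =
  cong₂ _+_ (sumTo-cong N (λ v 1≤v v≤N → h v 1≤v (m≤n⇒m≤1+n v≤N))) (h (suc N) (s≤s z≤n) ≤-refl)

sumTo-mono : ∀ {f g} N → (∀ v → f v ≤ g v) → sumTo f N ≤ sumTo g N
sumTo-mono zero h = z≤n
sumTo-mono (suc N) h = +-mono-≤ (sumTo-mono N h) (h (suc N))

+-interchange : ∀ a b c d → (a + b) + (c + d) ≡ (a + c) + (b + d)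
+-interchange = solve 4 (λ a b c d → (a :+ b) :+ (c :+ d) := (a :+ c) :+ (b :+ d)) refl

sumTo-+ : ∀ f g N → sumTo (λ v → f v + g v) N ≡ sumTo f N + sumTo g N
sumTo-+ f g zero = refl
sumTo-+ f g (suc N) =
  trans (cong (_+ (f (suc N) + g (suc N))) (sumTo-+ f g N))
        (+-interchange (sumTo f N) (sumTo g N) (f (suc N)) (g (suc N)))

sumTo-split : ∀ f m N → sumTo f (m + N) ≡ sumTo f m + sumTo (λ v → f (m + v)) N
sumTo-split f m zero rewrite +-identityʳ m = sym (+-identityʳ _)
sumTo-split f m (suc N) rewrite +-suc m N =
  trans (cong (_+ f (suc (m + N))) (sumTo-split f m N)) (+-assoc (sumTo f m) _ _)

sumTo≤N : ∀ f → (∀ v → f v ≤ 1) → ∀ N → sumTo f N ≤ N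
sumTo≤N f h zero = z≤n
sumTo≤N f h (suc N) = ≤-trans (+-mono-≤ (sumTo≤N f h N) (h (suc N))) (≤-reflexive (+-comm N 1))

odd? : ℕ → Bool
odd? v = v % 2 ≡ᵇ 1

sumOdd : ℕ → (ℕ → ℕ) → ℕ
sumOdd n w = sumTo (λ v → if odd? v then w v else 0) n

sumOdd-cong : ∀ n {f g} → (∀ v → 1 ≤ v → v ≤ n → odd? v ≡ true → f v ≡ g v) → sumOdd n f ≡ sumOdd n g
sumOdd-cong n {f} {g} h = sumTo-cong n pointwise
  where
  pointwise : ∀ v → 1 ≤ v → v ≤ n → (if odd? v then f v else 0) ≡ (if odd? v then g v else 0)
  pointwise v 1≤v v≤n with odd? v in odd
  ... | true = h v 1≤v v≤n odd
  ... | false = refl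

sumOdd-mono : ∀ n {f g} → (∀ v → f v ≤ g v) → sumOdd n f ≤ sumOdd n g
sumOdd-mono n {f} {g} h = sumTo-mono n λ v → pointwise v (odd? v)
  where
  pointwise : ∀ v b → (if b then f v else 0) ≤ (if b then g v else 0)
  pointwise v true = h v
  pointwise v false = z≤n

sumOdd≤sumTo : ∀ n f → sumOdd n f ≤ sumTo f n
sumOdd≤sumTo n f = sumTo-mono n λ v → dropped (odd? v)
  where
  dropped : ∀ {x} b → (if b then x else 0) ≤ x
  dropped true = ≤-refl
  dropped false = z≤n

sumOdd-+ : ∀ n f g → sumOdd n (λ v → f v + g v) ≡ sumOdd n f + sumOdd n g
sumOdd-+ n f g = trans (sumTo-cong n (λ v _ _ → distrib (odd? v))) (sumTo-+ _ _ n)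
  where
  distrib : ∀ {x y} b → (if b then x + y else 0) ≡ (if b then x else 0) + (if b then y else 0)
  distrib true = refl
  distrib false = refl

odd?-+even : ∀ t v → odd? (2 * t + v) ≡ odd? v
odd?-+even t v =
  cong (_≡ᵇ 1) (trans (cong (_% 2) (trans (+-comm (2 * t) v) (cong (v +_) (*-comm 2 t))))
                      ([m+kn]%n≡m%n v t 2))

two* : ∀ h → 2 * h ≡ h + h
two* h = cong (h +_) (+-identityʳ h)

sumOdd-halves : ∀ t w → sumOdd (2 * (2 * t)) w ≡ sumOdd (2 * t) w + sumOdd (2 * t) (λ v → w (2 * t + v))
sumOdd-halves t w rewrite two* (2 * t) =
  trans (sumTo-split _ (2 * t) (2 * t))
        (cong (sumOdd (2 * t) w +_)
              (sumTo-cong (2 * t) (λ v _ _ → cong (λ b → if b then w (2 * t + v) else 0) (odd?-+even t v))))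

nonZero-2^ : ∀ k → NonZero (2 ^ k)
nonZero-2^ k = m^n≢0 2 k

-- For y < 2h, the two residues y and y + h (mod 2h) are, as a set, the two
-- lifts y mod h and h + (y mod h) of a single residue modulo h.
residue-lifts : ∀ h .{{_ : NonZero h}} .{{_ : NonZero (2 * h)}} y → y < 2 * h → ∀ (w : ℕ → ℕ) →
  w y + w ((h + y) % (2 * h)) ≡ w (y % h) + w (h + y % h)
residue-lifts h y y<2h w with y <? h
... | yes y<h
  rewrite m<n⇒m%n≡m y<h | m<n⇒m%n≡m (subst (h + y <_) (sym (two* h)) (+-monoʳ-< h y<h)) = refl
... | no y≮h = subst (λ y → w y + w ((h + y) % (2 * h)) ≡ w (y % h) + w (h + y % h))
                     (m+[n∸m]≡n h≤y) upper
  where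
  h≤y : h ≤ y
  h≤y = ≮⇒≥ y≮h
  z : ℕ
  z = y ∸ h
  z<h : z < h
  z<h = m<n+o⇒m∸n<o y h (subst (y <_) (two* h) y<2h)
  z%h : (h + z) % h ≡ z
  z%h = trans (cong (_% h) (+-comm h z)) (trans ([m+n]%n≡m%n z h) (m<n⇒m%n≡m z<h))
  wrap : (h + (h + z)) % (2 * h) ≡ z
  wrap = trans (cong (_% (2 * h)) (solve 2 (λ h z → h :+ (h :+ z) := z :+ (con 2 :* h)) refl h z))
               (trans ([m+n]%n≡m%n z (2 * h)) (m<n⇒m%n≡m (m<n⇒m<o*n {z} {h} 2 z<h)))
  upper : w (h + z) + w ((h + (h + z)) % (2 * h)) ≡ w ((h + z) % h) + w (h + (h + z) % h)
  upper rewrite wrap | z%h = +-comm (w (h + z)) (w z)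

mulOdd-lifts : ∀ h .{{_ : NonZero h}} .{{_ : NonZero (2 * h)}} D → D % 2 ≡ 1 → ∀ σ (w : ℕ → ℕ) →
  w ((σ * D) % (2 * h)) + w (((h + σ) * D) % (2 * h)) ≡ w ((σ * D) % h) + w (h + (σ * D) % h)
mulOdd-lifts h D odd σ w = begin
  w ((σ * D) % (2 * h)) + w (((h + σ) * D) % (2 * h))
    ≡⟨ cong (λ u → w ((σ * D) % (2 * h)) + w u) shifted ⟩
  w ((σ * D) % (2 * h)) + w ((h + (σ * D) % (2 * h)) % (2 * h))
    ≡⟨ residue-lifts h ((σ * D) % (2 * h)) (m%n<n (σ * D) (2 * h)) w ⟩
  w ((σ * D) % (2 * h) % h) + w (h + (σ * D) % (2 * h) % h)
    ≡⟨ cong (λ u → w u + w (h + u)) (m∣n⇒o%n%m≡o%m h (2 * h) (σ * D) (divides 2 refl)) ⟩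
  w ((σ * D) % h) + w (h + (σ * D) % h) ∎
  where
  open ≡-Reasoning
  t : ℕ
  t = D / 2
  D≡ : D ≡ 1 + t * 2
  D≡ = trans (m≡m%n+[m/n]*n D 2) (cong (_+ t * 2) odd)
  -- (h + σ)·D = h + σ·D + t·2h, since h·D ≡ h (mod 2h) for odd D.
  expand : (h + σ) * D ≡ (h + σ * D) + t * (2 * h)
  expand = subst (λ D′ → (h + σ) * D′ ≡ (h + σ * D′) + t * (2 * h)) (sym D≡)
                 (solve 3 (λ h σ t → (h :+ σ) :* (con 1 :+ t :* con 2)
                                   := (h :+ σ :* (con 1 :+ t :* con 2)) :+ t :* (con 2 :* h)) refl h σ t)
  shifted : ((h + σ) * D) % (2 * h) ≡ (h + (σ * D) % (2 * h)) % (2 * h)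
  shifted = begin
    ((h + σ) * D) % (2 * h)             ≡⟨ cong (_% (2 * h)) expand ⟩
    (h + σ * D + t * (2 * h)) % (2 * h)  ≡⟨ [m+kn]%n≡m%n (h + σ * D) t (2 * h) ⟩
    (h + σ * D) % (2 * h)               ≡⟨ %-distribˡ-+ h (σ * D) (2 * h) ⟩
    (h % (2 * h) + (σ * D) % (2 * h)) % (2 * h)
      ≡⟨ cong (λ x → (h % (2 * h) + x) % (2 * h)) (sym (m%n%n≡m%n (σ * D) (2 * h))) ⟩
    (h % (2 * h) + (σ * D) % (2 * h) % (2 * h)) % (2 * h)
      ≡⟨ sym (%-distribˡ-+ h ((σ * D) % (2 * h)) (2 * h)) ⟩
    (h + (σ * D) % (2 * h)) % (2 * h) ∎

-- Multiplication by an odd D permutes the odd residues modulo 2^(k+1):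
-- summing w over σ·D mod n for odd σ ∈ [n] is summing w over odd residues.
sumOdd-mulOdd : ∀ k D → D % 2 ≡ 1 → ∀ (w : ℕ → ℕ) → .{{_ : NonZero (2 * 2 ^ k)}} →
  sumOdd (2 * 2 ^ k) (λ σ → w ((σ * D) % (2 * 2 ^ k))) ≡ sumOdd (2 * 2 ^ k) w
sumOdd-mulOdd zero D odd w = cong (λ u → (0 + w u) + 0) (trans (cong (_% 2) (*-identityˡ D)) odd)
sumOdd-mulOdd (suc k) D odd w = begin
  sumOdd (2 * h) (λ σ → w (σD σ))                                   ≡⟨ sumOdd-halves (2 ^ k) _ ⟩
  sumOdd h (λ σ → w (σD σ)) + sumOdd h (λ σ → w (σD (h + σ)))     ≡⟨ sym (sumOdd-+ h _ _) ⟩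
  sumOdd h (λ σ → w (σD σ) + w (σD (h + σ)))                       ≡⟨ sumOdd-cong h (λ σ _ _ _ → mulOdd-lifts h D odd σ w) ⟩
  sumOdd h (λ σ → lifts ((σ * D) % h))                              ≡⟨ sumOdd-mulOdd k D odd lifts ⟩
  sumOdd h lifts                                                    ≡⟨ sumOdd-+ h _ _ ⟩
  sumOdd h w + sumOdd h (λ v → w (h + v))                           ≡⟨ sym (sumOdd-halves (2 ^ k) w) ⟩
  sumOdd (2 * h) w ∎
  where
  open ≡-Reasoning
  h : ℕ
  h = 2 * 2 ^ k
  instance
    nonZero-h : NonZero h
    nonZero-h = nonZero-2^ (suc k)
  σD : ℕ → ℕ
  σD σ = (σ * D) % (2 * h)
  lifts : ℕ → ℕ
  lifts x = w x + w (h + x)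

nearZero : ℕ → ℕ → ℕ → Bool
nearZero B n e = (e * B ≤ᵇ n) ∨ ((n ∸ e) * B ≤ᵇ n)

≤ᵇ-⇔ : ∀ a b c d → (a ≤ b → c ≤ d) → (c ≤ d → a ≤ b) → (a ≤ᵇ b) ≡ (c ≤ᵇ d)
≤ᵇ-⇔ a b c d to from with a ≤ᵇ b in ab | c ≤ᵇ d in cd
... | true | true = refl
... | false | false = refl
... | true | false = ⊥-elim (subst T cd (≤⇒≤ᵇ (to (≤ᵇ⇒≤ a b (subst T (sym ab) _)))))
... | false | true = ⊥-elim (subst T ab (≤⇒≤ᵇ (from (≤ᵇ⇒≤ c d (subst T (sym cd) _)))))

≤ᵇ-double : ∀ a b → (2 * a ≤ᵇ 2 * b) ≡ (a ≤ᵇ b)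
≤ᵇ-double a b = ≤ᵇ-⇔ (2 * a) (2 * b) a b (*-cancelˡ-≤ 2) (*-monoʳ-≤ 2)

nearZero-double : ∀ B h x → nearZero B (2 * h) (2 * x) ≡ nearZero B h x
nearZero-double B h x = cong₂ _∨_
  (trans (cong (_≤ᵇ 2 * h) (*-assoc 2 x B)) (≤ᵇ-double (x * B) h))
  (trans (cong (λ u → u * B ≤ᵇ 2 * h) (sym (*-distribˡ-∸ 2 h x)))
    (trans (cong (_≤ᵇ 2 * h) (*-assoc 2 (h ∸ x) B)) (≤ᵇ-double ((h ∸ x) * B) h)))

few-small : ∀ B n N → sumTo (λ v → ind (v * B ≤ᵇ n)) N * B ≤ n
few-small B n zero = z≤n
few-small B n (suc N) with suc N * B ≤ᵇ n in small
... | true = ≤-trans (*-monoˡ-≤ B count≤N+1) (≤ᵇ⇒≤ _ _ (subst T (sym small) _))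
  where
  count≤N+1 : sumTo (λ v → ind (v * B ≤ᵇ n)) N + 1 ≤ suc N
  count≤N+1 = ≤-trans (≤-reflexive (+-comm _ 1)) (s≤s (sumTo≤N _ (λ v → ind≤1 (v * B ≤ᵇ n)) N))
... | false = subst (λ u → u * B ≤ n) (sym (+-identityʳ (sumTo (λ v → ind (v * B ≤ᵇ n)) N))) (few-small B n N)

true≢false : true ≡ false → ⊥
true≢false ()

-- 2t is even and 2t − 1 is odd (t > 0); n − 1 is the odd multiplier
-- realising the reflection below.
odd?-double : ∀ t → odd? (2 * t) ≡ false
odd?-double t = cong (_≡ᵇ 1) (trans (cong (_% 2) (*-comm 2 t)) (m*n%n≡0 t 2))

odd-pred : ∀ t → 0 < t → (2 * t ∸ 1) % 2 ≡ 1
odd-pred (suc t) _ = trans (cong (_% 2) twice) ([m+kn]%n≡m%n 1 t 2)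
  where
  twice : 2 * suc t ∸ 1 ≡ 1 + t * 2
  twice = trans (+-suc t (t + 0)) (cong suc (solve 1 (λ t → t :+ (t :+ con 0) := t :* con 2) refl t))

mul-pred≡reflect : ∀ n .{{_ : NonZero n}} v → 1 ≤ v → v < n → (v * (n ∸ 1)) % n ≡ n ∸ v
mul-pred≡reflect (suc m) (suc u) _ (s≤s u<m) =
  trans (cong (_% suc m) expand) (trans ([m+kn]%n≡m%n (m ∸ u) u (suc m)) (m<n⇒m%n≡m (s≤s (m∸n≤m m u))))
  where
  open ≡-Reasoning
  expand : suc u * m ≡ (m ∸ u) + u * suc m
  expand = begin
    m + u * m           ≡⟨ cong (_+ u * m) (sym (m∸n+n≡m (<⇒≤ u<m))) ⟩
    (m ∸ u + u) + u * m  ≡⟨ +-assoc (m ∸ u) u (u * m) ⟩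
    (m ∸ u) + (u + u * m) ≡⟨ cong ((m ∸ u) +_) (sym (*-suc u m)) ⟩
    (m ∸ u) + u * suc m ∎

-- By sumOdd-mulOdd this counts odd residues near zero; those with e·B ≤ n and,
-- via the reflection e ↦ n − e (multiplication by the odd n − 1), those with
-- (n − e)·B ≤ n, are each at most n/B.
nearZero-count-odd : ∀ B k D → D % 2 ≡ 1 → .{{_ : NonZero (2 * 2 ^ k)}} →
  sumOdd (2 * 2 ^ k) (λ σ → ind (nearZero B (2 * 2 ^ k) ((σ * D) % (2 * 2 ^ k)))) * B ≤ 2 * (2 * 2 ^ k)
nearZero-count-odd B k D odd = begin
  sumOdd n (λ σ → ind (nearZero B n ((σ * D) % n))) * B  ≡⟨ cong (_* B) (sumOdd-mulOdd k D odd (λ e → ind (nearZero B n e))) ⟩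
  sumOdd n (λ e → ind (nearZero B n e)) * B              ≤⟨ *-monoˡ-≤ B split ⟩
  (sumOdd n low + sumOdd n high) * B                      ≡⟨ cong (λ x → (sumOdd n low + x) * B) high≡low ⟩
  (sumOdd n low + sumOdd n low) * B                       ≡⟨ *-distribʳ-+ B (sumOdd n low) _ ⟩
  sumOdd n low * B + sumOdd n low * B                     ≤⟨ +-mono-≤ lowBound lowBound ⟩
  n + n                                                   ≡⟨ sym (two* n) ⟩
  2 * n ∎
  where
  open ≤-Reasoning
  n : ℕ
  n = 2 * 2 ^ k
  low high : ℕ → ℕ
  low e = ind (e * B ≤ᵇ n)
  high e = ind ((n ∸ e) * B ≤ᵇ n)
  split : sumOdd n (λ e → ind (nearZero B n e)) ≤ sumOdd n low + sumOdd n high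
  split = ≤-trans (sumOdd-mono n (λ e → ind-∨ (e * B ≤ᵇ n) _)) (≤-reflexive (sumOdd-+ n low high))
  reflect : ∀ v → 1 ≤ v → v ≤ n → odd? v ≡ true → high ((v * (n ∸ 1)) % n) ≡ low v
  reflect v 1≤v v≤n odd-v =
    cong (λ u → ind (u * B ≤ᵇ n)) (trans (cong (n ∸_) (mul-pred≡reflect n v 1≤v v<n)) (m∸[m∸n]≡n v≤n))
    where
    v<n : v < n
    v<n = ≤∧≢⇒< v≤n (λ v≡n → true≢false (trans (sym odd-v) (trans (cong odd? v≡n) (odd?-double (2 ^ k)))))
  high≡low : sumOdd n high ≡ sumOdd n low
  high≡low = trans (sym (sumOdd-mulOdd k (n ∸ 1) (odd-pred (2 ^ k) (m^n>0 2 k)) high)) (sumOdd-cong n reflect)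
  lowBound : sumOdd n low * B ≤ n
  lowBound = ≤-trans (*-monoˡ-≤ B (sumOdd≤sumTo n low)) (few-small B n n)

parity : ∀ D → D % 2 ≡ 0 ⊎ D % 2 ≡ 1
parity D with D % 2 | m%n<n D 2
... | 0 | _ = inj₁ refl
... | 1 | _ = inj₂ refl
... | suc (suc _) | s≤s (s≤s ())

%-cong-divisor : ∀ x a b → a ≡ b → .{{_ : NonZero a}} .{{_ : NonZero b}} → x % a ≡ x % b
%-cong-divisor x a .a refl = refl

-- Even multiplier 2D′ modulo 2h: σ·2D′ mod 2h = 2·(σ·D′ mod h), and this
-- depends only on σ mod h.  For even h the odd σ ∈ [2h] thus contribute twice
-- the count of odd σ ∈ [h] for D′ modulo h.
nearZero-count-even : ∀ B k D′ → let h = 2 * 2 ^ k in .{{_ : NonZero h}} .{{_ : NonZero (2 * h)}} →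
  sumOdd (2 * h) (λ σ → ind (nearZero B (2 * h) ((σ * (2 * D′)) % (2 * h))))
    ≡ sumOdd h (λ σ → ind (nearZero B h ((σ * D′) % h))) + sumOdd h (λ σ → ind (nearZero B h ((σ * D′) % h)))
nearZero-count-even B k D′ =
  trans (sumOdd-halves (2 ^ k) _)
        (cong₂ _+_ (sumOdd-cong h (λ σ _ _ _ → halve σ))
                   (sumOdd-cong h (λ σ _ _ _ → trans (halve (h + σ)) (cong (λ u → ind (nearZero B h u)) (periodic σ)))))
  where
  open ≡-Reasoning
  h : ℕ
  h = 2 * 2 ^ k
  instance
    nonZero-h*2 : NonZero (h * 2)
    nonZero-h*2 = m*n≢0 h 2
  halve : ∀ σ → ind (nearZero B (2 * h) ((σ * (2 * D′)) % (2 * h))) ≡ ind (nearZero B h ((σ * D′) % h))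
  halve σ = cong ind (begin
    nearZero B (2 * h) ((σ * (2 * D′)) % (2 * h))
      ≡⟨ cong (λ u → nearZero B (2 * h) (u % (2 * h))) (solve 2 (λ σ D → σ :* (con 2 :* D) := (σ :* D) :* con 2) refl σ D′) ⟩
    nearZero B (2 * h) ((σ * D′ * 2) % (2 * h))
      ≡⟨ cong (nearZero B (2 * h)) (%-cong-divisor _ _ _ (*-comm 2 h)) ⟩
    nearZero B (2 * h) ((σ * D′ * 2) % (h * 2))
      ≡⟨ cong (nearZero B (2 * h)) (sym (m%n*o≡m*o%[n*o] (σ * D′) h 2)) ⟩
    nearZero B (2 * h) (((σ * D′) % h) * 2)
      ≡⟨ cong (nearZero B (2 * h)) (*-comm ((σ * D′) % h) 2) ⟩
    nearZero B (2 * h) (2 * ((σ * D′) % h))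
      ≡⟨ nearZero-double B h ((σ * D′) % h) ⟩
    nearZero B h ((σ * D′) % h) ∎)
  periodic : ∀ σ → ((h + σ) * D′) % h ≡ (σ * D′) % h
  periodic σ = trans (cong (_% h) (solve 3 (λ h σ D → (h :+ σ) :* D := σ :* D :+ D :* h) refl h σ D′))
                     ([m+kn]%n≡m%n (σ * D′) D′ h)

even⇒twice-half : ∀ D → D % 2 ≡ 0 → D ≡ 2 * (D / 2)
even⇒twice-half D even = trans (m≡m%n+[m/n]*n D 2) (trans (cong (_+ (D / 2) * 2) even) (*-comm (D / 2) 2))

nearZero-count-halve : ∀ B k D → let h = 2 * 2 ^ k in .{{_ : NonZero h}} .{{_ : NonZero (2 * h)}} →
  D % 2 ≡ 0 →
  sumOdd h (λ σ → ind (nearZero B h ((σ * (D / 2)) % h))) * B ≤ 2 * h →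
  sumOdd (2 * h) (λ σ → ind (nearZero B (2 * h) ((σ * D) % (2 * h)))) * B ≤ 2 * (2 * h)
nearZero-count-halve B k D even half = begin
  sumOdd n (λ σ → ind (nearZero B n ((σ * D) % n))) * B        ≡⟨ cong (λ d → sumOdd n (λ σ → ind (nearZero B n ((σ * d) % n))) * B) D≡ ⟩
  sumOdd n (λ σ → ind (nearZero B n ((σ * (2 * D′)) % n))) * B ≡⟨ cong (_* B) (nearZero-count-even B k D′) ⟩
  (X + X) * B                                                  ≡⟨ *-distribʳ-+ B X X ⟩
  X * B + X * B                                                ≤⟨ +-mono-≤ half half ⟩
  2 * h + 2 * h                                                ≡⟨ sym (two* (2 * h)) ⟩
  2 * n ∎
  where
  open ≤-Reasoning
  h : ℕ
  h = 2 * 2 ^ k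
  n : ℕ
  n = 2 * h
  D′ : ℕ
  D′ = D / 2
  X : ℕ
  X = sumOdd h (λ σ → ind (nearZero B h ((σ * D′) % h)))
  D≡ : D ≡ 2 * D′
  D≡ = even⇒twice-half D even

halve-∤ : ∀ h D → D % 2 ≡ 0 → ¬ (2 * h ∣ D) → ¬ (h ∣ D / 2)
halve-∤ h D even 2h∤D h∣D/2 = 2h∤D (subst (2 * h ∣_) (sym (even⇒twice-half D even)) (*-monoʳ-∣ 2 h∣D/2))

nearZero-count-2^ : ∀ B k .{{_ : NonZero (2 ^ k)}} D → ¬ (2 ^ k ∣ D) →
  sumOdd (2 ^ k) (λ σ → ind (nearZero B (2 ^ k) ((σ * D) % 2 ^ k))) * B ≤ 2 * 2 ^ k
nearZero-count-2^ B zero D n∤D = ⊥-elim (n∤D (1∣ D))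
nearZero-count-2^ B (suc zero) D n∤D =
  [ (λ even → ⊥-elim (n∤D (m%n≡0⇒n∣m D 2 even))) , (λ odd → nearZero-count-odd B zero D odd) ]′ (parity D)
nearZero-count-2^ B (suc (suc k)) D n∤D =
  [ (λ even → nearZero-count-halve B k D {{nonZero-2^ (suc k)}} even
                (nearZero-count-2^ B (suc k) {{nonZero-2^ (suc k)}} (D / 2) (halve-∤ (2 ^ suc k) D even n∤D)))
  , (λ odd → nearZero-count-odd B (suc k) D odd) ]′ (parity D)

nearZero-count : ∀ B k n .{{_ : NonZero n}} → n ≡ 2 ^ k → ∀ D → ¬ (n ∣ D) →
  sumOdd n (λ σ → ind (nearZero B n ((σ * D) % n))) * B ≤ 2 * n
nearZero-count B k _ refl = nearZero-count-2^ B k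

round-close : ∀ n r → IsRoundDiv n r → ∀ x y → r x ≡ r y → x ≤ y + n
round-close n r round x y rx≡ry = *-cancelˡ-≤ 2 (begin
  2 * x             ≤⟨ proj₂ (round x) ⟩
  2 * n * r x + n   ≡⟨ cong (λ u → 2 * n * u + n) rx≡ry ⟩
  2 * n * r y + n   ≤⟨ +-monoˡ-≤ n (proj₁ (round y)) ⟩
  2 * y + n + n     ≡⟨ solve 2 (λ y n → con 2 :* y :+ n :+ n := con 2 :* (y :+ n)) refl y n ⟩
  2 * (y + n) ∎)
  where open ≤-Reasoning

-- π(i) − π(j) ≡ σ·(i − j) (mod n): the shift b cancels.  Here i − j is
-- represented by i + n − j, and π(i) = σ·(i + n − b) mod n.
perm-difference : ∀ m σ b i j → b ≤ suc m → j ≤ suc m →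
  perm (suc m) σ b i ≡ (perm (suc m) σ b j + (σ * (i + suc m ∸ j)) % suc m) % suc m
perm-difference m σ b i j b≤n j≤n = begin
  X % n               ≡⟨ sym ([m+kn]%n≡m%n X σ n) ⟩
  (X + σ * n) % n     ≡⟨ cong (_% n) σ-linear ⟩
  (Y + σ * D) % n     ≡⟨ %-distribˡ-+ Y (σ * D) n ⟩
  (Y % n + (σ * D) % n) % n ∎
  where
  open ≡-Reasoning
  n : ℕ
  n = suc m
  D : ℕ
  D = i + n ∸ j
  X : ℕ
  X = σ * (i + n ∸ b)
  Y : ℕ
  Y = σ * (j + n ∸ b)
  linear : (i + n ∸ b) + n ≡ (j + n ∸ b) + D
  linear = begin
    (i + n ∸ b) + n                 ≡⟨ cong (_+ n) (+-∸-assoc i b≤n) ⟩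
    i + (n ∸ b) + n                 ≡⟨ cong (λ u → i + (n ∸ b) + u) (sym (m+[n∸m]≡n j≤n)) ⟩
    i + (n ∸ b) + (j + (n ∸ j))     ≡⟨ solve 4 (λ i nb j nj → i :+ nb :+ (j :+ nj) := j :+ nb :+ (i :+ nj)) refl i (n ∸ b) j (n ∸ j) ⟩
    j + (n ∸ b) + (i + (n ∸ j))     ≡⟨ cong₂ _+_ (sym (+-∸-assoc j b≤n)) (sym (+-∸-assoc i j≤n)) ⟩
    (j + n ∸ b) + D ∎
  σ-linear : X + σ * n ≡ Y + σ * D
  σ-linear = trans (sym (*-distribˡ-+ σ _ n)) (trans (cong (σ *_) linear) (*-distribˡ-+ σ _ D))

-- If p ≡ q + e (mod n) and p·B, q·B are within n of each other, then e is
-- near zero: either q + e < n and e·B ≤ n, or q + e wraps around and (n − e)·B ≤ n.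
close⇒nearZero : ∀ n .{{_ : NonZero n}} B p q e → q < n → e < n → p ≡ (q + e) % n →
  p * B ≤ q * B + n → q * B ≤ p * B + n → T (nearZero B n e)
close⇒nearZero n B p q e q<n e<n p≡ pB≤ qB≤ with q + e <? n
... | yes q+e<n = Equivalence.from T-∨ (inj₁ (≤⇒≤ᵇ (+-cancelˡ-≤ (q * B) _ _ (begin
  q * B + e * B   ≡⟨ sym (*-distribʳ-+ B q e) ⟩
  (q + e) * B     ≡⟨ cong (_* B) (sym (trans p≡ (m<n⇒m%n≡m q+e<n))) ⟩
  p * B           ≤⟨ pB≤ ⟩
  q * B + n ∎))))
  where open ≤-Reasoning
... | no q+e≮n = Equivalence.from T-∨ (inj₂ (≤⇒≤ᵇ (+-cancelʳ-≤ (p * B) _ _ (begin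
  (n ∸ e) * B + p * B   ≡⟨ sym (*-distribʳ-+ B (n ∸ e) p) ⟩
  ((n ∸ e) + p) * B     ≡⟨ cong (_* B) unwrap ⟩
  q * B                 ≤⟨ qB≤ ⟩
  p * B + n             ≡⟨ +-comm (p * B) n ⟩
  n + p * B ∎))))
  where
  open ≤-Reasoning
  t : ℕ
  t = q + e ∸ n
  q+e≡ : q + e ≡ n + t
  q+e≡ = sym (m+[n∸m]≡n (≮⇒≥ q+e≮n))
  p≡t : p ≡ t
  p≡t = trans p≡ (trans (cong (_% n) (trans q+e≡ (+-comm n t)))
                 (trans ([m+n]%n≡m%n t n) (m<n⇒m%n≡m (m<n+o⇒m∸n<o (q + e) n (+-mono-< q<n e<n)))))
  unwrap : (n ∸ e) + p ≡ q
  unwrap = begin-equality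
    (n ∸ e) + p  ≡⟨ cong ((n ∸ e) +_) p≡t ⟩
    (n ∸ e) + t  ≡⟨ sym (+-∸-comm t (<⇒≤ e<n)) ⟩
    (n + t) ∸ e  ≡⟨ cong (_∸ e) (sym q+e≡) ⟩
    (q + e) ∸ e  ≡⟨ m+n∸n≡m q e ⟩
    q ∎

collision⇒nearZero : ∀ m B r → IsRoundDiv (suc m) r → ∀ σ b i j → b ≤ suc m → j ≤ suc m →
  hash (suc m) B r σ b j ≡ hash (suc m) B r σ b i →
  T (nearZero B (suc m) ((σ * (i + suc m ∸ j)) % suc m))
collision⇒nearZero m B r round σ b i j b≤n j≤n hj≡hi =
  close⇒nearZero n B (perm n σ b i) (perm n σ b j) ((σ * (i + n ∸ j)) % n)
    (m%n<n (σ * (j + n ∸ b)) n) (m%n<n (σ * (i + n ∸ j)) n)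
    (perm-difference m σ b i j b≤n j≤n)
    (round-close n r round _ _ (sym hj≡hi))
    (round-close n r round _ _ hj≡hi)
  where
  n : ℕ
  n = suc m

if-suc : ∀ b c → (if b then suc c else c) ≡ ind b + c
if-suc true c = refl
if-suc false c = refl

count-cons : ∀ {A : Set} (p : A → Bool) x xs → count p (x ∷ xs) ≡ ind (p x) + count p xs
count-cons p x xs = if-suc (p x) (count p xs)

count-++ : ∀ {A : Set} (p : A → Bool) xs ys → count p (xs ++ ys) ≡ count p xs + count p ys
count-++ p [] ys = refl
count-++ p (x ∷ xs) ys = begin
  count p (x ∷ xs ++ ys)                 ≡⟨ count-cons p x (xs ++ ys) ⟩
  ind (p x) + count p (xs ++ ys)         ≡⟨ cong (ind (p x) +_) (count-++ p xs ys) ⟩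
  ind (p x) + (count p xs + count p ys)  ≡⟨ sym (+-assoc (ind (p x)) _ _) ⟩
  ind (p x) + count p xs + count p ys    ≡⟨ cong (_+ count p ys) (sym (count-cons p x xs)) ⟩
  count p (x ∷ xs) + count p ys ∎
  where open ≡-Reasoning

count-map : ∀ {A B : Set} (p : B → Bool) (f : A → B) xs → count p (map f xs) ≡ count (λ x → p (f x)) xs
count-map p f [] = refl
count-map p f (x ∷ xs) with p (f x)
... | true = cong suc (count-map p f xs)
... | false = count-map p f xs

count≤length : ∀ {A : Set} (p : A → Bool) xs → count p xs ≤ length xs
count≤length p [] = z≤n
count≤length p (x ∷ xs) with p x
... | true = s≤s (count≤length p xs)
... | false = m≤n⇒m≤1+n (count≤length p xs)

count-none : ∀ {A : Set} (p : A → Bool) xs → All (λ x → ¬ T (p x)) xs → count p xs ≡ 0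
count-none p [] [] = refl
count-none p (x ∷ xs) (¬px ∷ rest) with p x
... | true = ⊥-elim (¬px _)
... | false = count-none p xs rest

count-filter : ∀ {A : Set} (p q : A → Bool) xs → count p (filterᵇ q xs) ≡ count (λ x → q x ∧ p x) xs
count-filter p q [] = refl
count-filter p q (x ∷ xs) with q x
... | true = trans (count-cons p x (filterᵇ q xs)) (trans (cong (ind (p x) +_) (count-filter p q xs))
                                                          (sym (if-suc (p x) _)))
... | false = count-filter p q xs

length-filter : ∀ {A : Set} (q : A → Bool) xs → length (filterᵇ q xs) ≡ count q xs
length-filter q [] = refl
length-filter q (x ∷ xs) with q x
... | true = cong suc (length-filter q xs)
... | false = length-filter q xs

range-snoc : ∀ n → range (suc n) ≡ range n ++ (suc n ∷ [])
range-snoc n = trans (cong (map suc) (sym (upTo-∷ʳ n))) (map-++ suc (upTo n) (n ∷ []))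

count-range : ∀ (p : ℕ → Bool) n → count p (range n) ≡ sumTo (λ v → ind (p v)) n
count-range p zero = refl
count-range p (suc n) =
  trans (cong (count p) (range-snoc n))
        (trans (count-++ p (range n) (suc n ∷ []))
               (cong₂ _+_ (count-range p n) (trans (count-cons p (suc n) []) (+-identityʳ _))))

length-range : ∀ n → length (range n) ≡ n
length-range n = trans (length-map suc (upTo n)) (length-upTo n)

all-range : ∀ n → All (_≤ n) (range n)
all-range n = map⁺ (all-upTo n)

count-odds : ∀ (p : ℕ → Bool) n → count p (odds n) ≡ sumOdd n (λ v → ind (p v))
count-odds p n = trans (count-filter p odd? (range n)) (trans (count-range _ n) (sumTo-cong n (λ v _ _ → ind-∧ (odd? v) (p v))))
  where
  ind-∧ : ∀ a b → ind (a ∧ b) ≡ (if a then ind b else 0)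
  ind-∧ true b = refl
  ind-∧ false b = refl

one-of-two-odd : ∀ N → ind (odd? (suc N)) + ind (odd? (suc (suc N))) ≡ 1
one-of-two-odd zero = refl
one-of-two-odd (suc N) =
  trans (cong (λ b → ind (odd? (suc (suc N))) + ind b) (odd?-+even 1 (suc N)))
        (trans (+-comm _ (ind (odd? (suc N)))) (one-of-two-odd N))

half-odd : ∀ n → n ≤ 2 * sumTo (λ v → ind (odd? v)) n
half-odd zero = z≤n
half-odd (suc zero) = s≤s z≤n
half-odd (suc (suc N)) = begin
  suc (suc N)                           ≤⟨ s≤s (s≤s (half-odd N)) ⟩
  2 + 2 * S                             ≡⟨ sym (*-distribˡ-+ 2 1 S) ⟩
  2 * (1 + S)                           ≡⟨ cong (2 *_) (sym two-more) ⟩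
  2 * (S + ind (odd? (suc N)) + ind (odd? (suc (suc N)))) ∎
  where
  open ≤-Reasoning
  S : ℕ
  S = sumTo (λ v → ind (odd? v)) N
  two-more : S + ind (odd? (suc N)) + ind (odd? (suc (suc N))) ≡ 1 + S
  two-more = trans (+-assoc S _ _) (trans (cong (S +_) (one-of-two-odd N)) (+-comm S 1))

length-odds : ∀ n → n ≤ 2 * length (odds n)
length-odds n =
  subst (λ u → n ≤ 2 * u) (sym (trans (length-filter odd? (range n)) (count-range odd? n))) (half-odd n)

sumOver : List ℕ → (ℕ → ℕ) → ℕ
sumOver [] f = 0
sumOver (j ∷ S) f = f j + sumOver S f

sumOver-+ : ∀ S (f g : ℕ → ℕ) → sumOver S (λ j → f j + g j) ≡ sumOver S f + sumOver S g
sumOver-+ [] f g = refl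
sumOver-+ (j ∷ S) f g =
  trans (cong (f j + g j +_) (sumOver-+ S f g)) (+-interchange (f j) (g j) (sumOver S f) (sumOver S g))

sumOver-cong : ∀ S {f g : ℕ → ℕ} → (∀ j → f j ≡ g j) → sumOver S f ≡ sumOver S g
sumOver-cong [] f≡g = refl
sumOver-cong (j ∷ S) f≡g = cong₂ _+_ (f≡g j) (sumOver-cong S f≡g)

sumOver-bound : ∀ {R : ℕ → Set} (f : ℕ → ℕ) B M S → All R S → (∀ j → R j → f j * B ≤ M) →
  sumOver S f * B ≤ length S * M
sumOver-bound f B M [] [] bound = z≤n
sumOver-bound f B M (j ∷ S) (rj ∷ rS) bound =
  ≤-trans (≤-reflexive (*-distribʳ-+ B (f j) (sumOver S f))) (+-mono-≤ (bound j rj) (sumOver-bound f B M S rS bound))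

ind-any : ∀ (f : ℕ → Bool) S → ind (any f S) ≤ sumOver S (λ j → ind (f j))
ind-any f [] = z≤n
ind-any f (j ∷ S) = ≤-trans (ind-∨ (f j) (any f S)) (+-monoʳ-≤ (ind (f j)) (ind-any f S))

count-union-bound : ∀ {A : Set} (P : A → Bool) (G : A → ℕ → Bool) S xs →
  (∀ x → ind (P x) ≤ sumOver S (λ j → ind (G x j))) →
  count P xs ≤ sumOver S (λ j → count (λ x → G x j) xs)
count-union-bound P G S [] covered = z≤n
count-union-bound P G S (x ∷ xs) covered = begin
  count P (x ∷ xs)                                                          ≡⟨ count-cons P x xs ⟩
  ind (P x) + count P xs                                                    ≤⟨ +-mono-≤ (covered x) (count-union-bound P G S xs covered) ⟩
  sumOver S (λ j → ind (G x j)) + sumOver S (λ j → count (λ x → G x j) xs)  ≡⟨ sym (sumOver-+ S _ _) ⟩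
  sumOver S (λ j → ind (G x j) + count (λ x → G x j) xs)                    ≡⟨ sumOver-cong S (λ j → sym (count-cons (λ x → G x j) x xs)) ⟩
  sumOver S (λ j → count (λ x → G x j) (x ∷ xs)) ∎
  where open ≤-Reasoning

count-product-bound : ∀ {A B : Set} (P : A × B → Bool) (Q : A → Bool) (R : B → Set) xs ys →
  (∀ x y → R y → T (P (x , y)) → T (Q x)) → All R ys →
  count P (cartesianProduct xs ys) ≤ count Q xs * length ys
count-product-bound P Q R [] ys forces rys = z≤n
count-product-bound P Q R (x ∷ xs) ys forces rys = begin
  count P (map (x ,_) ys ++ cartesianProduct xs ys)            ≡⟨ count-++ P (map (x ,_) ys) _ ⟩
  count P (map (x ,_) ys) + count P (cartesianProduct xs ys)   ≤⟨ +-mono-≤ row (count-product-bound P Q R xs ys forces rys) ⟩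
  ind (Q x) * length ys + count Q xs * length ys              ≡⟨ sym (*-distribʳ-+ (length ys) (ind (Q x)) _) ⟩
  (ind (Q x) + count Q xs) * length ys                         ≡⟨ cong (_* length ys) (sym (count-cons Q x xs)) ⟩
  count Q (x ∷ xs) * length ys ∎
  where
  open ≤-Reasoning
  row : count P (map (x ,_) ys) ≤ ind (Q x) * length ys
  row rewrite count-map P (x ,_) ys with Q x in qx
  ... | true = subst (count (λ y → P (x , y)) ys ≤_) (sym (+-identityʳ (length ys))) (count≤length _ ys)
  ... | false = ≤-reflexive (count-none _ ys (All.map
                  (λ {y} ry pxy → subst T qx (forces x y ry pxy)) rys))

-- For distinct i, j ∈ [n], the representative i + n − j of i − j is not a
-- multiple of n: it lies strictly between 0 and 2n and differs from n.
difference-not-divisible : ∀ n i j → 1 ≤ i → i ≤ n → 1 ≤ j → j ≤ n → j ≢ i → ¬ (n ∣ (i + n ∸ j))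
difference-not-divisible n i j 1≤i i≤n 1≤j j≤n j≢i (divides q eq) = multiple q (trans (sym (+-∸-assoc i j≤n)) eq)
  where
  multiple : ∀ q → i + (n ∸ j) ≡ q * n → ⊥
  multiple zero eq0 = <⇒≱ 1≤i (≤-reflexive (m+n≡0⇒m≡0 i eq0))
  multiple (suc zero) eq1 =
    j≢i (trans (sym (m∸[m∸n]≡n j≤n)) (trans (cong (_∸ (n ∸ j)) (sym (trans eq1 (+-identityʳ n))))
                                           (m+n∸n≡m i (n ∸ j))))
  multiple (suc (suc q)) eq2 = <⇒≱ below above
    where
    below : i + (n ∸ j) < n + n
    below = +-mono-≤-< i≤n (∸-monoʳ-< {n} {j} {0} 1≤j j≤n)
    above : n + n ≤ i + (n ∸ j)
    above = subst (n + n ≤_) (sym eq2) (+-monoʳ-≤ n (m≤m+n n (q * n)))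

module Collisions (k m B : ℕ) (n≡2^k : suc m ≡ 2 ^ k) (r : ℕ → ℕ) (round : IsRoundDiv (suc m) r)
                  (i : ℕ) (1≤i : 1 ≤ i) (i≤n : i ≤ suc m) where

  n : ℕ
  n = suc m

  pairs : List (ℕ × ℕ)
  pairs = cartesianProduct (odds n) (range n)

  collidesWith : ℕ × ℕ → ℕ → Bool
  collidesWith (σ , b) j = not (j ≡ᵇ i) ∧ (hash n B r σ b j ≡ᵇ hash n B r σ b i)

  badCount-union : ∀ S → badCount n B r S i ≤ sumOver S (λ j → count (λ x → collidesWith x j) pairs)
  badCount-union S = count-union-bound _ collidesWith S pairs (λ { (σ , b) → ind-any (collidesWith (σ , b)) S })

  never-self : ∀ x → ¬ T (collidesWith x i)
  never-self (σ , b) collision =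
    subst T (Equivalence.to T-not-≡ (proj₁ (Equivalence.to T-∧ collision))) (≡⇒≡ᵇ i i refl)

  -- A fixed j ∈ [n] collides with i for at most (2n/B) · n pairs (σ, b):
  -- at most 2n/B odd σ allow a collision at all, each with at most n shifts b.
  collisions-bound : ∀ j → (1 ≤ j) × (j ≤ n) → count (λ x → collidesWith x j) pairs * B ≤ (2 * n) * n
  collisions-bound j (1≤j , j≤n) with j ≟ i
  ... | yes refl = subst (λ c → c * B ≤ (2 * n) * n) (sym (count-none _ pairs (All.universal never-self pairs))) z≤n
  ... | no j≢i = begin
    count (λ x → collidesWith x j) pairs * B         ≤⟨ *-monoˡ-≤ B (count-product-bound _ near (_≤ n) (odds n) (range n) forces (all-range n)) ⟩
    count near (odds n) * length (range n) * B        ≡⟨ cong₂ (λ c l → c * l * B) (count-odds near n) (length-range n) ⟩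
    sumOdd n (λ σ → ind (near σ)) * n * B            ≡⟨ solve 3 (λ c n B → c :* n :* B := c :* B :* n) refl (sumOdd n (λ σ → ind (near σ))) n B ⟩
    sumOdd n (λ σ → ind (near σ)) * B * n            ≤⟨ *-monoˡ-≤ n (nearZero-count B k n n≡2^k D (difference-not-divisible n i j 1≤i i≤n 1≤j j≤n j≢i)) ⟩
    (2 * n) * n ∎
    where
    open ≤-Reasoning
    D : ℕ
    D = i + n ∸ j
    near : ℕ → Bool
    near σ = nearZero B n ((σ * D) % n)
    forces : ∀ σ b → b ≤ n → T (collidesWith (σ , b) j) → T (near σ)
    forces σ b b≤n collision =
      collision⇒nearZero m B r round σ b i j b≤n j≤n (≡ᵇ⇒≡ _ _ (proj₂ (Equivalence.to T-∧ collision)))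

claim3p1 : (k n B : ℕ) → n ≡ 2 ^ k → 1 ≤ B →
    (S : List ℕ) → Unique S → All (λ j → (1 ≤ j) × (j ≤ n)) S →
    (r : ℕ → ℕ) → IsRoundDiv n r →
    (i : ℕ) → i ∈ S →
    badCount n B r S i * B ≤ 4 * length S * (length (odds n) * n)
claim3p1 k zero B _ _ S _ inRange r _ i i∈S with All.lookup inRange i∈S
... | 1≤i , i≤0 = ⊥-elim (<⇒≱ 1≤i i≤0)
claim3p1 k (suc m) B n≡2^k _ S _ inRange r round i i∈S = begin
  badCount n B r S i * B                                       ≤⟨ *-monoˡ-≤ B (badCount-union S) ⟩
  sumOver S (λ j → count (λ x → collidesWith x j) pairs) * B  ≤⟨ sumOver-bound _ B _ S inRange collisions-bound ⟩
  length S * ((2 * n) * n)                                     ≤⟨ *-monoʳ-≤ (length S) (*-monoˡ-≤ n (*-monoʳ-≤ 2 (length-odds n))) ⟩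
  length S * ((2 * (2 * length (odds n))) * n)                 ≡⟨ solve 3 (λ s o n → s :* ((con 2 :* (con 2 :* o)) :* n) := con 4 :* s :* (o :* n)) refl (length S) (length (odds n)) n ⟩
  4 * length S * (length (odds n) * n) ∎
  where
  open ≤-Reasoning
  open Collisions k m B n≡2^k r round i (proj₁ (All.lookup inRange i∈S)) (proj₂ (All.lookup inRange i∈S))
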